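{- Let $\Gamma=\mathrm{Cay}(G,S)$ be a connected Cayley graph on the generalized dihedral group $G$ with $S\subseteq G\setminus\{e\}$ inverse-closed and $|S|=4$. If $|S\cap tA|=1$, then $\Gamma$ does not admit a perfect code.
   Context: $A$ is a finite abelian group and $G$ is a finite group containing $A$ as a subgroup of index $2$, together with an involution $t\in G\setminus A$ such that $tat=a^{ -1}$ for all $a\in A$; $tA=\{ta:a\in A\}$. $\mathrm{Cay}(G,S)$ has vertex set $G$, with $x,y$ adjacent iff $yx^{ -1}\in S$. A set $D$ of vertices is a perfect code if every vertex $x$ has exactly one element of $D$ in $\{x\}\cup N(x)$, where $N(x)$ is the neighbourhood of $x$. -}

module Defs where

open import Level using (Level; _⊔_; suc)
open import Algebra.Bundles using (AbelianGroup)
open import Data.Bool using (Bool; true; false)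
open import Data.Fin using (Fin)
open import Data.List using (List)
open import Data.List.Relation.Unary.Any using (Any)
open import Data.Product using (_×_; _,_; Σ; ∃; proj₁; proj₂)
open import Data.Sum using (_⊎_)
open import Relation.Nullary using (¬_)
open import Relation.Binary.PropositionalEquality using (_≡_)
open import Relation.Binary.Construct.Closure.ReflexiveTransitive using (Star)
open import Relation.Unary using (Pred)

IsFiniteAbelianGroup : ∀ {c ℓ} → AbelianGroup c ℓ → Set (c ⊔ ℓ)
IsFiniteAbelianGroup A =
  Σ (List Carrier) λ xs → ∀ x → Any (λ y → x ≈ y) xs
  where open AbelianGroup A

-- The generalized dihedral group Dih(A) = A ⋊ ⟨t⟩, t² = e, t a t = a⁻¹.
-- The pair (a , s) represents the element a · t^s  (s = true means t¹).
-- Hence A = {(a , false)} and tA = {(a , true)} (since t a = a⁻¹ t).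
module Dih {c ℓ} (A : AbelianGroup c ℓ) where
  open AbelianGroup A renaming (Carrier to Car)

  G : Set c
  G = Car × Bool

  _≈G_ : G → G → Set ℓ
  (a , s) ≈G (b , r) = (a ≈ b) × (s ≡ r)

  e : G
  e = (ε , false)

  xor : Bool → Bool → Bool
  xor false r = r
  xor true false = true
  xor true true = false

  -- (a t^s)(b t^r) = a (t^s b t^s) t^(s+r)
  _·_ : G → G → G
  (a , false) · (b , r) = (a ∙ b , r)
  (a , true)  · (b , r) = (a ∙ (b ⁻¹) , xor true r)

  -- inverse: (a)⁻¹ = a⁻¹ ; (a t)⁻¹ = t a⁻¹ = a t
  inv : G → G
  inv (a , false) = (a ⁻¹ , false)
  inv (a , true) = (a , true)

  InTA : G → Set
  InTA (a , s) = s ≡ true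

  _∈S_ : G → (Fin 4 → G) → Set ℓ
  x ∈S S = ∃ λ i → x ≈G S i

  Adj : (Fin 4 → G) → G → G → Set ℓ
  Adj S x y = (y · inv x) ∈S S

  Connected : (Fin 4 → G) → Set (c ⊔ ℓ)
  Connected S = ∀ x y → Star (Adj S) x y

  InClosedNbhd : (Fin 4 → G) → G → G → Set ℓ
  InClosedNbhd S x y = (y ≈G x) ⊎ Adj S x y

  IsPerfectCode : ∀ {p} → (Fin 4 → G) → Pred G p → Set (c ⊔ ℓ ⊔ p)
  IsPerfectCode S D =
    ∀ x → ∃ λ d → D d × InClosedNbhd S x d ×
          (∀ d′ → D d′ → InClosedNbhd S x d′ → d′ ≈G d)

  Distinct4 : (Fin 4 → G) → Set ℓ
  Distinct4 S = ∀ i j → S i ≈G S j → i ≡ j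

  AvoidsId : (Fin 4 → G) → Set ℓ
  AvoidsId S = ∀ i → ¬ (S i ≈G e)

  InverseClosed : (Fin 4 → G) → Set ℓ
  InverseClosed S = ∀ i → inv (S i) ∈S S

  ExactlyOneInTA : (Fin 4 → G) → Set
  ExactlyOneInTA S = ∃ λ i → InTA (S i) × (∀ j → InTA (S j) → j ≡ i)

{-# OPTIONS --safe #-}
module Submission where

-- Write S = {c₀ t} ∪ T with T = S ∩ A. Left multiplication by the reflection c₀ t sends
-- x ∈ A to c₀ x⁻¹ t, so renaming y t ↦ c₀ y⁻¹ on the coset tA turns Cay(G, S) into the
-- prism Cay(A, T) □ K₂: two copies of Cay(A, T) joined by rungs (x, 0) — (x, 1).
-- The prism is vertex-transitive, so a perfect code D may be assumed to contain (ε, 0).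
-- Then every u ∈ T has a partner u′ ∈ T ∖ {u⁻¹} with (u′ u, 1) ∈ D, and two such code
-- words that share a factor coincide. If T consists of three involutions, partners would
-- pair off the three elements of T. Otherwise T = {a, b, b⁻¹} with a involutive and b
-- not; the partner β ∈ {b, b⁻¹} of a forces β⁻¹ to be its own partner, and then no
-- code word is left to dominate the vertex (a β⁻¹, 0).

open import Level using (_⊔_)
open import Algebra.Bundles using (AbelianGroup; Group)
open import Data.Bool using (Bool; true; false; not; _xor_)
open import Data.Bool.Properties using (not-¬; not-distribˡ-xor)
open import Data.Empty using (⊥; ⊥-elim)
open import Data.Fin using (Fin; zero; suc; punchIn; punchOut)
open import Data.Fin.Properties using (punchInᵢ≢i; punchIn-injective; punchIn-punchOut)
open import Data.Product using (_×_; _,_; proj₁; proj₂; ∃; ∃₂)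
open import Data.Product.Relation.Binary.Pointwise.NonDependent using (_×ₛ_)
open import Data.Sum using (_⊎_; inj₁; inj₂; [_,_]; swap; assocˡ; assocʳ; map₁; map₂)
open import Function using (_∘_)
open import Relation.Binary.Bundles using (Setoid)
open import Relation.Binary.Core using (Rel)
open import Relation.Binary.Definitions using (_Respects_)
import Relation.Binary.PropositionalEquality as ≡
open ≡ using (_≡_; _≢_)
open import Relation.Nullary using (¬_)
open import Relation.Unary using (Pred)
open import Defs

PerfectCode : ∀ {v ℓ n p} {V : Set v} → Rel V ℓ → Rel V n → Pred V p → Set (v ⊔ ℓ ⊔ n ⊔ p)
PerfectCode _≈_ N D = ∀ x → ∃ λ d → D d × N x d × (∀ d′ → D d′ → N x d′ → d′ ≈ d)

module Pullback {v w ℓ₁ ℓ₂ n₁ n₂} (V : Setoid v ℓ₁) (W : Setoid w ℓ₂)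
  (N₁ : Rel (Setoid.Carrier V) n₁) (N₂ : Rel (Setoid.Carrier W) n₂)
  (f : Setoid.Carrier V → Setoid.Carrier W) where

  open Setoid V using () renaming (_≈_ to _≈₁_)
  open Setoid W using (sym; trans) renaming (_≈_ to _≈₂_)

  preimage : ∀ {p} → Pred (Setoid.Carrier W) p → Pred (Setoid.Carrier V) (w ⊔ ℓ₂ ⊔ p)
  preimage D x = ∃ λ y → D y × y ≈₂ f x

  preimage-resp : ∀ {p} {D : Pred (Setoid.Carrier W) p} →
    (∀ {x y} → x ≈₁ y → f x ≈₂ f y) → preimage D Respects _≈₁_
  preimage-resp f-cong x≈y (z , Dz , z≈fx) = z , Dz , trans z≈fx (f-cong x≈y)

  preimage-perfectCode : ∀ {p} {D : Pred (Setoid.Carrier W) p} →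
    (∀ {x y} → N₁ x y → N₂ (f x) (f y)) →
    (∀ {x z} → N₂ (f x) z → ∃ λ y → N₁ x y × z ≈₂ f y) →
    (∀ {x y} → f x ≈₂ f y → x ≈₁ y) →
    (∀ {x} → N₂ x Respects _≈₂_) →
    PerfectCode _≈₂_ N₂ D → PerfectCode _≈₁_ N₁ (preimage D)
  preimage-perfectCode preserves lifts injective N₂-resp code x with code (f x)
  ... | d , Dd , Nd , closest with lifts Nd
  ...   | y , Ny , d≈fy = y , (d , Dd , d≈fy) , Ny , λ y′ (z , Dz , z≈fy′) Ny′ →
    injective (trans (sym z≈fy′) (trans (closest z Dz (N₂-resp (sym z≈fy′) (preserves Ny′))) d≈fy))

module Prism {c ℓ r} (A : AbelianGroup c ℓ) (T : Pred (AbelianGroup.Carrier A) r) where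

  open AbelianGroup A
  open import Algebra.Properties.AbelianGroup A
  open import Algebra.Properties.CommutativeSemigroup commutativeSemigroup using (x∙yz≈y∙xz)
  open import Relation.Binary.Reasoning.Setoid setoid

  Vertex : Set c
  Vertex = Carrier × Bool

  𝕍 : Setoid c ℓ
  𝕍 = setoid ×ₛ ≡.setoid Bool

  open Setoid 𝕍 using () renaming (_≈_ to _≈ᵥ_; sym to ≈ᵥ-sym; trans to ≈ᵥ-trans)

  data Nbhd : Rel Vertex (c ⊔ ℓ ⊔ r) where
    centre : ∀ {x y s} → y ≈ x → Nbhd (x , s) (y , s)
    edge   : ∀ {x y s u} → T u → y ≈ u ∙ x → Nbhd (x , s) (y , s)
    rung   : ∀ {x y s} → y ≈ x → Nbhd (x , s) (y , not s)

  Nbhd-respʳ : ∀ {v} → Nbhd v Respects _≈ᵥ_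
  Nbhd-respʳ (y≈y′ , ≡.refl) (centre y≈x)   = centre (trans (sym y≈y′) y≈x)
  Nbhd-respʳ (y≈y′ , ≡.refl) (edge Tu y≈ux) = edge Tu (trans (sym y≈y′) y≈ux)
  Nbhd-respʳ (y≈y′ , ≡.refl) (rung y≈x)     = rung (trans (sym y≈y′) y≈x)

  _*_ : Vertex → Vertex → Vertex
  (x , s) * (δ , σ) = x ∙ δ , s xor σ

  xor-cancelʳ : ∀ σ {s s′} → s xor σ ≡ s′ xor σ → s ≡ s′
  xor-cancelʳ _     {false} {false} _  = ≡.refl
  xor-cancelʳ _     {true}  {true}  _  = ≡.refl
  xor-cancelʳ false {false} {true}  ()
  xor-cancelʳ true  {false} {true}  ()
  xor-cancelʳ false {true}  {false} ()
  xor-cancelʳ true  {true}  {false} ()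

  *-cong : ∀ g {v w} → v ≈ᵥ w → v * g ≈ᵥ w * g
  *-cong (δ , σ) (x≈y , s≡r) = ∙-congʳ x≈y , ≡.cong (_xor σ) s≡r

  *-injective : ∀ g {v w} → v * g ≈ᵥ w * g → v ≈ᵥ w
  *-injective (δ , σ) {x , _} {y , _} (xδ≈yδ , e) = ∙-cancelʳ δ x y xδ≈yδ , xor-cancelʳ σ e

  *-preserves : ∀ g {v w} → Nbhd v w → Nbhd (v * g) (w * g)
  *-preserves (δ , σ) (centre y≈x)   = centre (∙-congʳ y≈x)
  *-preserves (δ , σ) (edge Tu y≈ux) = edge Tu (trans (∙-congʳ y≈ux) (assoc _ _ δ))
  *-preserves (δ , σ) {x , s} {y , _} (rung y≈x) =
    ≡.subst (λ s′ → Nbhd (x ∙ δ , s xor σ) (y ∙ δ , s′)) (not-distribˡ-xor s σ) (rung (∙-congʳ y≈x))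

  *-lifts : ∀ g {v z} → Nbhd (v * g) z → ∃ λ w → Nbhd v w × z ≈ᵥ w * g
  *-lifts (δ , σ) {x , s} (centre y≈xδ) = (x , s) , centre refl , y≈xδ , ≡.refl
  *-lifts (δ , σ) {x , s} (edge {u = u} Tu y≈u[xδ]) =
    (u ∙ x , s) , edge Tu refl , trans y≈u[xδ] (sym (assoc u x δ)) , ≡.refl
  *-lifts (δ , σ) {x , s} (rung y≈xδ) = (x , not s) , rung refl , y≈xδ , not-distribˡ-xor s σ

  recentre : ∀ {p} {D : Pred Vertex p} → PerfectCode _≈ᵥ_ Nbhd D →
    ∃ λ (D′ : Pred Vertex (c ⊔ ℓ ⊔ p)) →
      PerfectCode _≈ᵥ_ Nbhd D′ × D′ Respects _≈ᵥ_ × D′ (ε , false)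
  recentre {D = D} code with code (ε , false)
  ... | (δ , σ) , Dg , _ =
    preimage D ,
    preimage-perfectCode (*-preserves g) (*-lifts g) (*-injective g) Nbhd-respʳ code ,
    preimage-resp (*-cong g) ,
    (g , Dg , sym (identityˡ δ) , ≡.refl)
    where
    g : Vertex
    g = δ , σ
    open Pullback 𝕍 𝕍 Nbhd Nbhd (_* g)

  Within : Carrier → Carrier → Carrier → Set (c ⊔ ℓ ⊔ r)
  Within x y z = ∀ {u} → T u → u ≈ x ⊎ u ≈ y ⊎ u ≈ z

  InvolutionAndPair : Set (c ⊔ ℓ ⊔ r)
  InvolutionAndPair = ∃₂ λ a b → T a × a ⁻¹ ≈ a × T b × b ⁻¹ ≉ b × Within a b (b ⁻¹)

  module _ (T-inv : ∀ {u} → T u → T (u ⁻¹)) where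

    pair-up : ∀ {x y z} → T x → T y → x ≉ y → x ≉ z → y ≉ z → Within x y z →
      y ⁻¹ ≈ z → InvolutionAndPair
    pair-up {x} {y} {z} Tx Ty x≉y x≉z y≉z within y⁻¹≈z with within (T-inv Tx)
    ... | inj₁ x⁻¹≈x =
      x , y , Tx , x⁻¹≈x , Ty , (λ y⁻¹≈y → y≉z (trans (sym y⁻¹≈y) y⁻¹≈z)) ,
      λ Tu → map₂ (map₂ (λ u≈z → trans u≈z (sym y⁻¹≈z))) (within Tu)
    ... | inj₂ (inj₁ x⁻¹≈y) = ⊥-elim (x≉z (trans (sym (⁻¹-selfInverse x⁻¹≈y)) y⁻¹≈z))
    ... | inj₂ (inj₂ x⁻¹≈z) = ⊥-elim (x≉y (⁻¹-injective (trans x⁻¹≈z (sym y⁻¹≈z))))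

    classify : ∀ {x₀ x₁ x₂} → T x₀ → T x₁ → T x₂ → x₀ ≉ x₁ → x₀ ≉ x₂ → x₁ ≉ x₂ →
      Within x₀ x₁ x₂ → InvolutionAndPair ⊎ (x₀ ⁻¹ ≈ x₀ × x₁ ⁻¹ ≈ x₁ × x₂ ⁻¹ ≈ x₂)
    classify T₀ T₁ T₂ x₀≉x₁ x₀≉x₂ x₁≉x₂ within with within (T-inv T₀)
    ... | inj₂ (inj₁ x₀⁻¹≈x₁) =
      inj₁ (pair-up T₂ T₀ (x₀≉x₂ ∘ sym) (x₁≉x₂ ∘ sym) x₀≉x₁ (swap ∘ assocˡ ∘ within) x₀⁻¹≈x₁)
    ... | inj₂ (inj₂ x₀⁻¹≈x₂) =
      inj₁ (pair-up T₁ T₀ (x₀≉x₁ ∘ sym) x₁≉x₂ x₀≉x₂ (assocʳ ∘ map₁ swap ∘ assocˡ ∘ within) x₀⁻¹≈x₂)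
    ... | inj₁ x₀⁻¹≈x₀ with within (T-inv T₁)
    ...   | inj₁ x₁⁻¹≈x₀ = ⊥-elim (x₀≉x₁ (⁻¹-injective (trans x₀⁻¹≈x₀ (sym x₁⁻¹≈x₀))))
    ...   | inj₂ (inj₂ x₁⁻¹≈x₂) = inj₁ (pair-up T₀ T₁ x₀≉x₁ x₀≉x₂ x₁≉x₂ within x₁⁻¹≈x₂)
    ...   | inj₂ (inj₁ x₁⁻¹≈x₁) with within (T-inv T₂)
    ...     | inj₁ x₂⁻¹≈x₀ = ⊥-elim (x₀≉x₂ (⁻¹-injective (trans x₀⁻¹≈x₀ (sym x₂⁻¹≈x₀))))
    ...     | inj₂ (inj₁ x₂⁻¹≈x₁) = ⊥-elim (x₁≉x₂ (⁻¹-injective (trans x₁⁻¹≈x₁ (sym x₂⁻¹≈x₁))))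
    ...     | inj₂ (inj₂ x₂⁻¹≈x₂) = inj₂ (x₀⁻¹≈x₀ , x₁⁻¹≈x₁ , x₂⁻¹≈x₂)

    module _ (T-resp : T Respects _≈_) (ε∉T : ¬ T ε) where

      module Centred {p} (D : Pred Vertex p) (code : PerfectCode _≈ᵥ_ Nbhd D)
        (D-resp : D Respects _≈ᵥ_) (D₀ : D (ε , false)) where

        D-cong : ∀ {x y s} → x ≈ y → D (x , s) → D (y , s)
        D-cong x≈y = D-resp (x≈y , ≡.refl)

        D-comm : ∀ {x y s} → D (x ∙ y , s) → D (y ∙ x , s)
        D-comm = D-cong (comm _ _)

        unique : ∀ {v w w′} → D w → D w′ → Nbhd v w → Nbhd v w′ → w ≈ᵥ w′
        unique {v} {w} {w′} Dw Dw′ Nw Nw′ with code v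
        ... | _ , _ , _ , closest = ≈ᵥ-trans (closest w Dw Nw) (≈ᵥ-sym (closest w′ Dw′ Nw′))

        ¬D-rung : ∀ {x s} → D (x , s) → D (x , not s) → ⊥
        ¬D-rung Dx Dx′ = not-¬ ≡.refl (proj₂ (unique Dx Dx′ (centre refl) (rung refl)))

        ¬D-edge : ∀ {u x s} → T u → D (x , s) → D (u ∙ x , s) → ⊥
        ¬D-edge {u} {x} Tu Dx Dux =
          ε∉T (T-resp (identityˡ-unique u x (sym x≈ux)) Tu)
          where
          x≈ux : x ≈ u ∙ x
          x≈ux = proj₁ (unique Dx Dux (centre refl) (edge Tu refl))

        ¬D-edge-rung : ∀ {u x s} → T u → D (u ∙ x , s) → D (x , not s) → ⊥
        ¬D-edge-rung Tu Dux Dx = not-¬ ≡.refl (proj₂ (unique Dux Dx (edge Tu refl) (rung refl)))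

        D-edge-edge : ∀ {u u′ x s} → T u → T u′ → D (u ∙ x , s) → D (u′ ∙ x , s) → u ≈ u′
        D-edge-edge {u} {u′} {x} Tu Tu′ Dux Du′x =
          ∙-cancelʳ x u u′ (proj₁ (unique Dux Du′x (edge Tu refl) (edge Tu′ refl)))

        partner : ∀ {u} → T u → ∃ λ u′ → T u′ × u′ ≉ u ⁻¹ × D (u′ ∙ u , true)
        partner {u} Tu with code (u , true)
        ... | _ , Dy , centre y≈u , _ =
          ⊥-elim (¬D-edge-rung Tu (D-cong (trans y≈u (sym (identityʳ u))) Dy) D₀)
        ... | _ , Dy , edge {u = u′} Tu′ y≈u′u , _ =
          u′ , Tu′ , u′≉u⁻¹ , D-cong y≈u′u Dy
          where
          u′≉u⁻¹ : u′ ≉ u ⁻¹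
          u′≉u⁻¹ u′≈u⁻¹ = ¬D-rung (D-cong (trans y≈u′u (trans (∙-congʳ u′≈u⁻¹) (inverseˡ u))) Dy) D₀
        ... | _ , Dy , rung y≈u , _ =
          ⊥-elim (¬D-edge Tu D₀ (D-cong (trans y≈u (sym (identityʳ u))) Dy))

        ¬partners : ∀ {x y z} → T x → T y → T z → z ⁻¹ ≈ z → x ≉ z → y ≉ z → Within x y z →
          ¬ D (y ∙ x , true)
        ¬partners Tx Ty Tz z⁻¹≈z x≉z y≉z within Dyx with partner Tz
        ... | u′ , Tu′ , u′≉z⁻¹ , Du′z with within Tu′
        ... | inj₁ u′≈x = y≉z (sym (D-edge-edge Tz Ty (D-comm (D-cong (∙-congʳ u′≈x) Du′z)) Dyx))
        ... | inj₂ (inj₁ u′≈y) =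
          x≉z (sym (D-edge-edge Tz Tx (D-comm (D-cong (∙-congʳ u′≈y) Du′z)) (D-comm Dyx)))
        ... | inj₂ (inj₂ u′≈z) = u′≉z⁻¹ (trans u′≈z (sym z⁻¹≈z))

        ¬three-involutions : ∀ {x₀ x₁ x₂} → T x₀ → T x₁ → T x₂ →
          x₀ ⁻¹ ≈ x₀ → x₁ ⁻¹ ≈ x₁ → x₂ ⁻¹ ≈ x₂ → x₀ ≉ x₁ → x₀ ≉ x₂ → x₁ ≉ x₂ →
          Within x₀ x₁ x₂ → ⊥
        ¬three-involutions T₀ T₁ T₂ x₀⁻¹≈x₀ x₁⁻¹≈x₁ x₂⁻¹≈x₂ x₀≉x₁ x₀≉x₂ x₁≉x₂ within with partner T₀
        ... | u′ , Tu′ , u′≉x₀⁻¹ , Du′x₀ with within Tu′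
        ... | inj₁ u′≈x₀ = u′≉x₀⁻¹ (trans u′≈x₀ (sym x₀⁻¹≈x₀))
        ... | inj₂ (inj₁ u′≈x₁) =
          ¬partners T₀ T₁ T₂ x₂⁻¹≈x₂ x₀≉x₂ x₁≉x₂ within (D-cong (∙-congʳ u′≈x₁) Du′x₀)
        ... | inj₂ (inj₂ u′≈x₂) =
          ¬partners T₀ T₂ T₁ x₁⁻¹≈x₁ x₀≉x₁ (x₁≉x₂ ∘ sym) (map₂ swap ∘ within)
            (D-cong (∙-congʳ u′≈x₂) Du′x₀)

        module _ {a β} (Ta : T a) (a⁻¹≈a : a ⁻¹ ≈ a) (Tβ : T β) (β⁻¹≉β : β ⁻¹ ≉ β)
          (within : Within a β (β ⁻¹)) (Dβa : D (β ∙ a , true)) where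

          private
            Tβ⁻¹ : T (β ⁻¹)
            Tβ⁻¹ = T-inv Tβ

            ¬Daβ⁻¹ : ¬ D (a ∙ β ⁻¹ , true)
            ¬Daβ⁻¹ Daβ⁻¹ = β⁻¹≉β (D-edge-edge Tβ⁻¹ Tβ (D-comm Daβ⁻¹) Dβa)

            a≉β : a ≉ β
            a≉β a≈β = β⁻¹≉β (trans (⁻¹-cong (sym a≈β)) (trans a⁻¹≈a a≈β))

            ¬Dβ⁻¹β⁻¹ : ¬ D (β ⁻¹ ∙ β ⁻¹ , true)
            ¬Dβ⁻¹β⁻¹ Dβ⁻¹β⁻¹ with code (a ∙ β ⁻¹ , false)
            ... | _ , Dy , centre y≈aβ⁻¹ , _ =
              a≉β (D-edge-edge Ta Tβ (D-cong y≈aβ⁻¹ Dy) (D-cong (sym (inverseʳ β)) D₀))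
            ... | _ , Dy , rung y≈aβ⁻¹ , _ = ¬Daβ⁻¹ (D-cong y≈aβ⁻¹ Dy)
            ... | _ , Dy , edge {u = u} Tu y≈u[aβ⁻¹] , _ with within Tu
            ...   | inj₁ u≈a = ¬D-edge Tβ⁻¹ D₀ (D-cong (begin
              _                   ≈⟨ y≈u[aβ⁻¹] ⟩
              u ∙ (a ∙ β ⁻¹)      ≈⟨ ∙-congʳ (trans u≈a (sym a⁻¹≈a)) ⟩
              a ⁻¹ ∙ (a ∙ β ⁻¹)   ≈⟨ \\-leftDividesʳ a (β ⁻¹) ⟩
              β ⁻¹                ≈⟨ identityʳ (β ⁻¹) ⟨
              β ⁻¹ ∙ ε            ∎) Dy)
            ...   | inj₂ (inj₁ u≈β) = ¬D-edge Ta D₀ (D-cong (begin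
              _                   ≈⟨ y≈u[aβ⁻¹] ⟩
              u ∙ (a ∙ β ⁻¹)      ≈⟨ ∙-congʳ u≈β ⟩
              β ∙ (a ∙ β ⁻¹)      ≈⟨ x∙yz≈y∙xz β a (β ⁻¹) ⟩
              a ∙ (β ∙ β ⁻¹)      ≈⟨ ∙-congˡ (inverseʳ β) ⟩
              a ∙ ε               ∎) Dy)
            ...   | inj₂ (inj₂ u≈β⁻¹) = ¬D-edge-rung Ta (D-cong (begin
              _                   ≈⟨ y≈u[aβ⁻¹] ⟩
              u ∙ (a ∙ β ⁻¹)      ≈⟨ ∙-congʳ u≈β⁻¹ ⟩
              β ⁻¹ ∙ (a ∙ β ⁻¹)   ≈⟨ x∙yz≈y∙xz (β ⁻¹) a (β ⁻¹) ⟩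
              a ∙ (β ⁻¹ ∙ β ⁻¹)   ∎) Dy) Dβ⁻¹β⁻¹

          ¬partner-of-involution : ⊥
          ¬partner-of-involution with partner Tβ⁻¹
          ... | u′ , Tu′ , u′≉β⁻¹⁻¹ , Du′β⁻¹ with within Tu′
          ... | inj₁ u′≈a = ¬Daβ⁻¹ (D-cong (∙-congʳ u′≈a) Du′β⁻¹)
          ... | inj₂ (inj₁ u′≈β) = u′≉β⁻¹⁻¹ (trans u′≈β (sym (⁻¹-involutive β)))
          ... | inj₂ (inj₂ u′≈β⁻¹) = ¬Dβ⁻¹β⁻¹ (D-cong (∙-congʳ u′≈β⁻¹) Du′β⁻¹)

        ¬involution-and-pair : InvolutionAndPair → ⊥
        ¬involution-and-pair (a , b , Ta , a⁻¹≈a , Tb , b⁻¹≉b , within) with partner Ta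
        ... | u′ , Tu′ , u′≉a⁻¹ , Du′a with within Tu′
        ... | inj₁ u′≈a = u′≉a⁻¹ (trans u′≈a (sym a⁻¹≈a))
        ... | inj₂ (inj₁ u′≈b) =
          ¬partner-of-involution Ta a⁻¹≈a Tb b⁻¹≉b within (D-cong (∙-congʳ u′≈b) Du′a)
        ... | inj₂ (inj₂ u′≈b⁻¹) =
          ¬partner-of-involution Ta a⁻¹≈a (T-inv Tb) b⁻¹⁻¹≉b⁻¹ within′
            (D-cong (∙-congʳ u′≈b⁻¹) Du′a)
          where
          b≈b⁻¹⁻¹ : b ≈ b ⁻¹ ⁻¹
          b≈b⁻¹⁻¹ = sym (⁻¹-involutive b)

          b⁻¹⁻¹≉b⁻¹ : b ⁻¹ ⁻¹ ≉ b ⁻¹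
          b⁻¹⁻¹≉b⁻¹ b⁻¹⁻¹≈b⁻¹ = b⁻¹≉b (sym (trans b≈b⁻¹⁻¹ b⁻¹⁻¹≈b⁻¹))

          within′ : Within a (b ⁻¹) (b ⁻¹ ⁻¹)
          within′ Tu = map₂ (swap ∘ map₁ (λ u≈b → trans u≈b b≈b⁻¹⁻¹)) (within Tu)

      no-perfectCode : ∀ {p x₀ x₁ x₂} {D : Pred Vertex p} → T x₀ → T x₁ → T x₂ →
        x₀ ≉ x₁ → x₀ ≉ x₂ → x₁ ≉ x₂ → Within x₀ x₁ x₂ → ¬ PerfectCode _≈ᵥ_ Nbhd D
      no-perfectCode T₀ T₁ T₂ x₀≉x₁ x₀≉x₂ x₁≉x₂ within code with recentre code
      ... | D′ , code′ , D′-resp , D′₀ =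
        [ ¬involution-and-pair
        , (λ (x₀⁻¹≈x₀ , x₁⁻¹≈x₁ , x₂⁻¹≈x₂) →
            ¬three-involutions T₀ T₁ T₂ x₀⁻¹≈x₀ x₁⁻¹≈x₁ x₂⁻¹≈x₂ x₀≉x₁ x₀≉x₂ x₁≉x₂ within)
        ] (classify T₀ T₁ T₂ x₀≉x₁ x₀≉x₂ x₁≉x₂ within)
        where open Centred D′ code′ D′-resp D′₀

module Untwisting {c ℓ} (A : AbelianGroup c ℓ) (S : Fin 4 → Dih.G A) (i₀ : Fin 4)
  (S-i₀∈tA : Dih.InTA A (S i₀)) (unique₀ : ∀ j → Dih.InTA A (S j) → j ≡ i₀) where

  open AbelianGroup A
  open Group group using (_//_; _\\_)
  open import Algebra.Properties.AbelianGroup A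
  open Dih A using (_·_; inv; _∈S_; InClosedNbhd; AvoidsId; InverseClosed; Distinct4)
  open import Relation.Binary.Reasoning.Setoid setoid

  S∩A : Pred Carrier ℓ
  S∩A x = (x , false) ∈S S

  open Prism A S∩A using (Vertex; 𝕍; Nbhd; centre; edge; rung; Within)
  open Setoid 𝕍 using () renaming (_≈_ to _≈ᵥ_; sym to ≈ᵥ-sym; trans to ≈ᵥ-trans)

  S∩A-resp : S∩A Respects _≈_
  S∩A-resp x≈y (i , x≈Si , s≡) = i , trans (sym x≈y) x≈Si , s≡

  inv-cong : ∀ {g h} → g ≈ᵥ h → inv g ≈ᵥ inv h
  inv-cong {_ , false} {_ , false} (x≈y , _) = ⁻¹-cong x≈y , ≡.refl
  inv-cong {_ , true}  {_ , true}  (x≈y , _) = x≈y , ≡.refl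

  S∩A-inv : InverseClosed S → ∀ {x} → S∩A x → S∩A (x ⁻¹)
  S∩A-inv inverseClosed (i , x∼Si) with inverseClosed i
  ... | j , Si⁻¹∼Sj = j , ≈ᵥ-trans (inv-cong x∼Si) Si⁻¹∼Sj

  ε∉S∩A : AvoidsId S → ¬ S∩A ε
  ε∉S∩A avoidsId (i , ε∼Si) = avoidsId i (≈ᵥ-sym ε∼Si)

  c₀ : Carrier
  c₀ = proj₁ (S i₀)

  reflection∈S : ∀ {z} → z ≈ c₀ → (z , true) ∈S S
  reflection∈S z≈c₀ = i₀ , z≈c₀ , ≡.sym S-i₀∈tA

  reflection-unique : ∀ {z} → (z , true) ∈S S → z ≈ c₀
  reflection-unique (i , z≈Si , true≡) with unique₀ i (≡.sym true≡)
  ... | ≡.refl = z≈Si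

  twist : Carrier → Carrier
  twist x = c₀ // x

  twist-involutive : ∀ x → twist (twist x) ≈ x
  twist-involutive x = begin
    c₀ ∙ (c₀ // x) ⁻¹   ≈⟨ ∙-congˡ (⁻¹-anti-homo-// c₀ x) ⟩
    c₀ ∙ (x ∙ c₀ ⁻¹)    ≈⟨ assoc c₀ x (c₀ ⁻¹) ⟨
    c₀ ∙ x ∙ c₀ ⁻¹      ≈⟨ xyx⁻¹≈y c₀ x ⟩
    x                   ∎

  twist-injective : ∀ {x y} → twist x ≈ twist y → x ≈ y
  twist-injective {x} {y} e = ⁻¹-injective (∙-cancelˡ c₀ (x ⁻¹) (y ⁻¹) e)

  twist-// : ∀ x y → twist y // twist x ≈ x // y
  twist-// x y = begin
    (c₀ // y) ∙ (c₀ // x) ⁻¹   ≈⟨ ∙-congˡ (⁻¹-anti-homo-// c₀ x) ⟩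
    (c₀ // y) ∙ (x // c₀)      ≈⟨ comm _ _ ⟩
    (x ∙ c₀ ⁻¹) ∙ (c₀ ∙ y ⁻¹)  ≈⟨ assoc x (c₀ ⁻¹) _ ⟩
    x ∙ (c₀ \\ (c₀ ∙ y ⁻¹))    ≈⟨ ∙-congˡ (\\-leftDividesʳ c₀ (y ⁻¹)) ⟩
    x // y                     ∎

  twist-rungˡ : ∀ x → twist x // x ⁻¹ ≈ c₀
  twist-rungˡ x = trans (∙-congˡ (⁻¹-involutive x)) (//-rightDividesˡ x c₀)

  twist-rungʳ : ∀ x → x ∙ twist x ≈ c₀
  twist-rungʳ x = trans (comm x (twist x)) (//-rightDividesˡ x c₀)

  untwist : Vertex → Vertex
  untwist (x , false) = x , false
  untwist (x , true)  = twist x , true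

  untwist-cong : ∀ {v w} → v ≈ᵥ w → untwist v ≈ᵥ untwist w
  untwist-cong {_ , false} {_ , false} (x≈y , _) = x≈y , ≡.refl
  untwist-cong {_ , true}  {_ , true}  (x≈y , _) = //-cong₂ refl x≈y , ≡.refl

  untwist-involutive : ∀ v → untwist (untwist v) ≈ᵥ v
  untwist-involutive (x , false) = refl , ≡.refl
  untwist-involutive (x , true)  = twist-involutive x , ≡.refl

  untwist-injective : ∀ {v w} → untwist v ≈ᵥ untwist w → v ≈ᵥ w
  untwist-injective {v} {w} e =
    ≈ᵥ-trans (≈ᵥ-sym (untwist-involutive v)) (≈ᵥ-trans (untwist-cong e) (untwist-involutive w))

  ·-congʳ : ∀ {g g′ h} → g ≈ᵥ g′ → g · h ≈ᵥ g′ · h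
  ·-congʳ {_ , false} {_ , false} (x≈x′ , _) = ∙-congʳ x≈x′ , ≡.refl
  ·-congʳ {_ , true}  {_ , true}  (x≈x′ , _) = ∙-congʳ x≈x′ , ≡.refl

  InClosedNbhd-respʳ : ∀ {g} → InClosedNbhd S g Respects _≈ᵥ_
  InClosedNbhd-respʳ h≈h′ (inj₁ h≈g)      = inj₁ (≈ᵥ-trans (≈ᵥ-sym h≈h′) h≈g)
  InClosedNbhd-respʳ h≈h′ (inj₂ (i , m)) = inj₂ (i , ≈ᵥ-trans (·-congʳ (≈ᵥ-sym h≈h′)) m)

  module _ (inverseClosed : InverseClosed S) where

    untwist-preserves : ∀ {v w} → Nbhd v w → InClosedNbhd S (untwist v) (untwist w)
    untwist-preserves {x , s} {y , _} (centre y≈x) =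
      inj₁ (untwist-cong {y , s} {x , s} (y≈x , ≡.refl))
    untwist-preserves {x , false} {y , false} (edge {u = u} Tu y≈ux) =
      inj₂ (S∩A-resp (x≈z//y u x y (sym y≈ux)) Tu)
    untwist-preserves {x , true} {y , true} (edge {u = u} Tu y≈ux) =
      inj₂ (S∩A-resp u⁻¹≈ (S∩A-inv inverseClosed Tu))
      where
      u⁻¹≈ : u ⁻¹ ≈ twist y // twist x
      u⁻¹≈ = begin
        u ⁻¹              ≈⟨ ⁻¹-cong (x≈z//y u x y (sym y≈ux)) ⟩
        (y // x) ⁻¹       ≈⟨ ⁻¹-anti-homo-// y x ⟩
        x // y            ≈⟨ twist-// x y ⟨
        twist y // twist x ∎
    untwist-preserves {x , false} (rung y≈x) =
      inj₂ (reflection∈S (trans (∙-congʳ (//-cong₂ refl y≈x)) (twist-rungˡ x)))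
    untwist-preserves {x , true} (rung y≈x) =
      inj₂ (reflection∈S (trans (∙-congʳ y≈x) (twist-rungʳ x)))

    untwist-reflects : ∀ v w → InClosedNbhd S (untwist v) (untwist w) → Nbhd v w
    untwist-reflects (x , s) (y , r) (inj₁ e) with untwist-injective {y , r} {x , s} e
    ... | y≈x , ≡.refl = centre y≈x
    untwist-reflects (x , false) (y , false) (inj₂ m) = edge m (sym (//-rightDividesˡ x y))
    untwist-reflects (x , false) (y , true) (inj₂ m) =
      rung (twist-injective (∙-cancelʳ (x ⁻¹ ⁻¹) _ _
        (trans (reflection-unique m) (sym (twist-rungˡ x)))))
    untwist-reflects (x , true) (y , false) (inj₂ m) =
      rung (∙-cancelʳ (twist x) y x (trans (reflection-unique m) (sym (twist-rungʳ x))))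
    untwist-reflects (x , true) (y , true) (inj₂ m) = edge (S∩A-inv inverseClosed m) (sym (begin
      (twist y // twist x) ⁻¹ ∙ x  ≈⟨ ∙-congʳ (⁻¹-cong (twist-// x y)) ⟩
      (x // y) ⁻¹ ∙ x              ≈⟨ ∙-congʳ (⁻¹-anti-homo-// x y) ⟩
      (y // x) ∙ x                 ≈⟨ //-rightDividesˡ x y ⟩
      y                            ∎))

    untwist-lifts : ∀ {v h} → InClosedNbhd S (untwist v) h → ∃ λ w → Nbhd v w × h ≈ᵥ untwist w
    untwist-lifts {v} {h} n =
      untwist h , untwist-reflects v (untwist h) (InClosedNbhd-respʳ (≈ᵥ-sym h≈) n) , ≈ᵥ-sym h≈
      where
      h≈ : untwist (untwist h) ≈ᵥ h
      h≈ = untwist-involutive h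

  layer-false : ∀ {j} → j ≢ i₀ → proj₂ (S j) ≡ false
  layer-false {j} j≢i₀ with proj₂ (S j) in eq
  ... | false = ≡.refl
  ... | true  = ⊥-elim (j≢i₀ (unique₀ j eq))

  rotation : Fin 3 → Carrier
  rotation k = proj₁ (S (punchIn i₀ k))

  rotation∈S∩A : ∀ k → S∩A (rotation k)
  rotation∈S∩A k = punchIn i₀ k , refl , ≡.sym (layer-false (punchInᵢ≢i i₀ k))

  rotations-distinct : Distinct4 S → ∀ {j k} → j ≢ k → rotation j ≉ rotation k
  rotations-distinct distinct {j} {k} j≢k e = j≢k (punchIn-injective i₀ j k (distinct _ _
    (e , ≡.trans (layer-false (punchInᵢ≢i i₀ j)) (≡.sym (layer-false (punchInᵢ≢i i₀ k))))))

  S∩A-rotations : ∀ {u} → S∩A u → ∃ λ k → u ≈ rotation k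
  S∩A-rotations {u} (j , u≈Sj , false≡) =
    punchOut i₀≢j , ≡.subst (λ i → u ≈ proj₁ (S i)) (≡.sym (punchIn-punchOut i₀≢j)) u≈Sj
    where
    i₀≢j : i₀ ≢ j
    i₀≢j ≡.refl with ≡.trans false≡ S-i₀∈tA
    ... | ()

  S∩A-within : Within (rotation zero) (rotation (suc zero)) (rotation (suc (suc zero)))
  S∩A-within Tu with S∩A-rotations Tu
  ... | zero           , e = inj₁ e
  ... | suc zero       , e = inj₂ (inj₁ e)
  ... | suc (suc zero) , e = inj₂ (inj₂ e)

lemma2p1 : ∀ {c ℓ p} (A : AbelianGroup c ℓ) → IsFiniteAbelianGroup A →
    (S : Fin 4 → Dih.G A) →
    Dih.Distinct4 A S → Dih.AvoidsId A S → Dih.InverseClosed A S →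
    Dih.Connected A S → Dih.ExactlyOneInTA A S →
    ¬ (∃ λ (D : Pred (Dih.G A) p) → Dih.IsPerfectCode A S D)
lemma2p1 A _ S distinct avoidsId inverseClosed _ (i₀ , S-i₀∈tA , unique₀) (D , perfect) =
  no-perfectCode (S∩A-inv inverseClosed) S∩A-resp (ε∉S∩A avoidsId)
    (rotation∈S∩A zero) (rotation∈S∩A (suc zero)) (rotation∈S∩A (suc (suc zero)))
    (rotations-distinct distinct (λ ())) (rotations-distinct distinct (λ ()))
    (rotations-distinct distinct (λ ()))
    S∩A-within
    (preimage-perfectCode (untwist-preserves inverseClosed) (untwist-lifts inverseClosed)
      untwist-injective InClosedNbhd-respʳ perfect)
  where
  open Untwisting A S i₀ S-i₀∈tA unique₀
  open Prism A S∩A using (𝕍; Nbhd; no-perfectCode)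
  open Pullback 𝕍 𝕍 Nbhd (Dih.InClosedNbhd A S) untwist
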